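{- Let $\mathbf L=(L,\vee,\wedge)$ be a finite lattice with least element $0$ and greatest element $1$, and let $a\in L$. Then (i) $|P_{\{a\}}(\mathbf L)|$ is odd; (ii) $|P_{\{a\}}(\mathbf L)|\geq2|L|-1$; (iii) $|L|\leq(|P_{\{a\}}(\mathbf L)|+1)/2$; (iv) $|P_{\{a\}}(\mathbf L)|\geq2|[0,a]|\cdot|[a,1]|-1$.
   Context: For a lattice $\mathbf L$ and $S\subseteq L$, $P_S(\mathbf L):=\{(x,y)\in L^2\mid x\wedge y\leq z\leq x\vee y\text{ for all }z\in S\}$. $[c,d]$ denotes the interval $\{x\in L\mid c\leq x\leq d\}$. -}

module Defs where

open import Level using (0ℓ)
open import Data.Nat using (ℕ)
open import Data.Fin using (Fin)
open import Data.List using (List; length; filter; allFin; cartesianProduct)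
open import Data.Product using (_×_; _,_; proj₁; proj₂)
open import Relation.Binary.Core using (Rel)
open import Relation.Binary.Definitions using (Decidable)
open import Relation.Binary.PropositionalEquality using (_≡_)
open import Relation.Binary.Lattice.Structures using (IsBoundedLattice)
open import Relation.Nullary using (Dec; yes; no)
open import Relation.Nullary.Decidable using (_×-dec_)

-- Decidability of ≤ is included only so that subsets can be counted;
-- it is automatic for a finite lattice (x ≤ y iff x ∧ y ≡ y is decidable on Fin n).
record FiniteBoundedLattice (n : ℕ) : Set₁ where
  field
    _≤_ : Rel (Fin n) 0ℓ
    _∨_ : Fin n → Fin n → Fin n
    _∧_ : Fin n → Fin n → Fin n
    ⊤ : Fin n
    ⊥ : Fin n
    isBoundedLattice : IsBoundedLattice _≡_ _≤_ _∨_ _∧_ ⊤ ⊥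
    _≤?_ : Decidable _≤_

module _ {n : ℕ} (L : FiniteBoundedLattice n) where
  open FiniteBoundedLattice L

  card : ℕ
  card = n

  InP : Fin n → Fin n × Fin n → Set
  InP a (x , y) = ((x ∧ y) ≤ a) × (a ≤ (x ∨ y))

  InP? : (a : Fin n) → (p : Fin n × Fin n) → Dec (InP a p)
  InP? a (x , y) = ((x ∧ y) ≤? a) ×-dec (a ≤? (x ∨ y))

  cardP : Fin n → ℕ
  cardP a = length (filter (InP? a) (cartesianProduct (allFin n) (allFin n)))

  InInterval : Fin n → Fin n → Fin n → Set
  InInterval c d x = (c ≤ x) × (x ≤ d)

  InInterval? : (c d x : Fin n) → Dec (InInterval c d x)
  InInterval? c d x = (c ≤? x) ×-dec (x ≤? d)

  cardInterval : Fin n → Fin n → ℕ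
  cardInterval c d = length (filter (InInterval? c d) (allFin n))

{-# OPTIONS --safe #-}
-- P_{a} is a symmetric relation on L whose diagonal is {(a , a)}, because
-- x ∧ x ≤ a ≤ x ∨ x forces x = a; its off-diagonal pairs come in swapped couples,
-- so |P_{a}| is odd. If A × B ⊆ P_{a} and A ∩ B ⊆ {a}, then A × B and its
-- transpose lie in P_{a} and overlap at most in (a , a), so 2|A||B| − 1 ≤ |P_{a}|.
-- A = {a}, B = L gives (ii), and with oddness (iii); A = [0,a], B = [a,1] gives (iv).
module Submission where

open import Defs
open import Level using (0ℓ)
open import Data.Bool.Base using (true; false; if_then_else_)
open import Data.Nat.Base using (ℕ; zero; suc; _+_; _*_; _∸_; _≤_; _/_; _%_; z≤n)
open import Data.Nat.Properties hiding (_≟_)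
open import Data.Nat.DivMod using ([m+kn]%n≡m%n; m*n/n≡m)
import Data.Nat.ListAction as List
open import Data.Nat.ListAction.Properties using (sum-++)
open import Data.Nat.Tactic.RingSolver using (solve-∀)
open import Data.Fin.Base using (Fin; zero; suc)
open import Data.Fin.Properties using (_≟_)
open import Data.List.Base using (List; []; _∷_; _++_; map; filter; length; allFin; tabulate; cartesianProduct)
open import Data.List.Properties using (map-++; map-∘; map-tabulate)
open import Data.Product.Base using (_×_; _,_; ∃)
open import Data.Unit.Base using (tt)
open import Function.Base using (_∘_; id)
open import Function.Bundles using (_⇔_; mk⇔)
open import Relation.Binary.Lattice.Bundles using (Lattice)
open import Relation.Binary.Lattice.Structures using (IsBoundedLattice)
open import Relation.Binary.PropositionalEquality
open import Relation.Nullary.Decidable using (Dec; yes; no; does; _×-dec_; dec-true; does-⇔)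
open import Relation.Unary using (Pred; Decidable)
open import Algebra.Properties.Semiring.Sum +-*-semiring
  using (sum; sum-syntax; sum-cong-≗; sum-replicate-zero; ∑-distrib-+; ∑-comm;
         *-distribˡ-sum; *-distribʳ-sum)

𝟙 : {P : Set} → Dec P → ℕ
𝟙 P? = if does P? then 1 else 0

𝟙-yes : {P : Set} (P? : Dec P) → P → 𝟙 P? ≡ 1
𝟙-yes P? p = cong (if_then 1 else 0) (dec-true P? p)

𝟙-⇔ : {P Q : Set} → P ⇔ Q → (P? : Dec P) (Q? : Dec Q) → 𝟙 P? ≡ 𝟙 Q?
𝟙-⇔ P⇔Q P? Q? = cong (if_then 1 else 0) (does-⇔ P⇔Q P? Q?)

𝟙-×-dec : {P Q : Set} (P? : Dec P) (Q? : Dec Q) → 𝟙 (P? ×-dec Q?) ≡ 𝟙 P? * 𝟙 Q?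
𝟙-×-dec P? Q? with does P? | does Q?
... | true  | true  = refl
... | true  | false = refl
... | false | _     = refl

length-filter : {A : Set} {P : Pred A 0ℓ} (P? : Decidable P) (xs : List A) →
  length (filter P? xs) ≡ List.sum (map (𝟙 ∘ P?) xs)
length-filter P? [] = refl
length-filter P? (x ∷ xs) with does (P? x)
... | true  = cong suc (length-filter P? xs)
... | false = length-filter P? xs

sum-tabulate : ∀ {n} (f : Fin n → ℕ) → List.sum (tabulate f) ≡ ∑[ i < n ] f i
sum-tabulate {zero}  f = refl
sum-tabulate {suc n} f = cong (f zero +_) (sum-tabulate (f ∘ suc))

sum-map-allFin : ∀ {n} (f : Fin n → ℕ) → List.sum (map f (allFin n)) ≡ ∑[ i < n ] f i
sum-map-allFin f = trans (cong List.sum (map-tabulate id f)) (sum-tabulate f)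

sum-map-cartesianProduct : {A B : Set} (h : A × B → ℕ) (xs : List A) (ys : List B) →
  List.sum (map h (cartesianProduct xs ys))
    ≡ List.sum (map (λ x → List.sum (map (λ y → h (x , y)) ys)) xs)
sum-map-cartesianProduct h [] ys = refl
sum-map-cartesianProduct h (x ∷ xs) ys = begin
    List.sum (map h (map (x ,_) ys ++ cartesianProduct xs ys))
  ≡⟨ cong List.sum (map-++ h (map (x ,_) ys) (cartesianProduct xs ys)) ⟩
    List.sum (map h (map (x ,_) ys) ++ map h (cartesianProduct xs ys))
  ≡⟨ sum-++ (map h (map (x ,_) ys)) (map h (cartesianProduct xs ys)) ⟩
    List.sum (map h (map (x ,_) ys)) + List.sum (map h (cartesianProduct xs ys))
  ≡⟨ cong₂ _+_ (cong List.sum (sym (map-∘ ys))) (sum-map-cartesianProduct h xs ys) ⟩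
    List.sum (map (λ y → h (x , y)) ys) + List.sum (map (λ x → List.sum (map (λ y → h (x , y)) ys)) xs)
  ∎
  where open ≡-Reasoning

length-filter-allFin : ∀ {n} {P : Pred (Fin n) 0ℓ} (P? : Decidable P) →
  length (filter P? (allFin n)) ≡ ∑[ x < n ] 𝟙 (P? x)
length-filter-allFin {n} P? = trans (length-filter P? (allFin n)) (sum-map-allFin (𝟙 ∘ P?))

length-filter-allFin² : ∀ {n} {P : Pred (Fin n × Fin n) 0ℓ} (P? : Decidable P) →
  length (filter P? (cartesianProduct (allFin n) (allFin n)))
    ≡ ∑[ x < n ] ∑[ y < n ] 𝟙 (P? (x , y))
length-filter-allFin² {n} P? = begin
    length (filter P? (cartesianProduct (allFin n) (allFin n)))
  ≡⟨ length-filter P? (cartesianProduct (allFin n) (allFin n)) ⟩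
    List.sum (map (𝟙 ∘ P?) (cartesianProduct (allFin n) (allFin n)))
  ≡⟨ sum-map-cartesianProduct (𝟙 ∘ P?) (allFin n) (allFin n) ⟩
    List.sum (map (λ x → List.sum (map (λ y → 𝟙 (P? (x , y))) (allFin n))) (allFin n))
  ≡⟨ sum-map-allFin (λ x → List.sum (map (λ y → 𝟙 (P? (x , y))) (allFin n))) ⟩
    ∑[ x < n ] List.sum (map (λ y → 𝟙 (P? (x , y))) (allFin n))
  ≡⟨ sum-cong-≗ (λ x → sum-map-allFin (λ y → 𝟙 (P? (x , y)))) ⟩
    ∑[ x < n ] ∑[ y < n ] 𝟙 (P? (x , y))
  ∎
  where open ≡-Reasoning

∑-mono-≤ : ∀ {n} {f g : Fin n → ℕ} → (∀ i → f i ≤ g i) → ∑[ i < n ] f i ≤ ∑[ i < n ] g i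
∑-mono-≤ {zero}  f≤g = z≤n
∑-mono-≤ {suc n} f≤g = +-mono-≤ (f≤g zero) (∑-mono-≤ (f≤g ∘ suc))

∑-const-1 : ∀ n → ∑[ i < n ] 1 ≡ n
∑-const-1 zero    = refl
∑-const-1 (suc n) = cong suc (∑-const-1 n)

∑-𝟙-≟ : ∀ {n} (a : Fin n) → ∑[ x < n ] 𝟙 (x ≟ a) ≡ 1
∑-𝟙-≟ {suc n} zero    = cong suc (sum-replicate-zero n)
∑-𝟙-≟ {suc n} (suc a) = ∑-𝟙-≟ a

∑∑-distrib-+ : ∀ {m n} (f g : Fin m → Fin n → ℕ) →
  ∑[ x < m ] ∑[ y < n ] (f x y + g x y) ≡ ∑[ x < m ] ∑[ y < n ] f x y + ∑[ x < m ] ∑[ y < n ] g x y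
∑∑-distrib-+ {n = n} f g = trans (sum-cong-≗ (λ x → ∑-distrib-+ (f x) (g x)))
  (∑-distrib-+ (λ x → ∑[ y < n ] f x y) (λ x → ∑[ y < n ] g x y))

∑∑-* : ∀ {m n} (u : Fin m → ℕ) (v : Fin n → ℕ) →
  ∑[ x < m ] ∑[ y < n ] (u x * v y) ≡ ∑[ x < m ] u x * ∑[ y < n ] v y
∑∑-* u v = begin
    ∑[ x < _ ] ∑[ y < _ ] (u x * v y)
  ≡⟨ sum-cong-≗ (λ x → sym (*-distribˡ-sum (u x) v)) ⟩
    ∑[ x < _ ] (u x * sum v)
  ≡⟨ sym (*-distribʳ-sum (sum v) u) ⟩
    sum u * sum v
  ∎
  where open ≡-Reasoning

strictUpperSum : ∀ {n} → (Fin n → Fin n → ℕ) → ℕ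
strictUpperSum {zero}  f = 0
strictUpperSum {suc n} f = ∑[ y < n ] f zero (suc y) + strictUpperSum (λ x y → f (suc x) (suc y))

∑∑-symmetric : ∀ {n} (f : Fin n → Fin n → ℕ) → (∀ x y → f x y ≡ f y x) →
  ∑[ x < n ] ∑[ y < n ] f x y ≡ ∑[ x < n ] f x x + 2 * strictUpperSum f
∑∑-symmetric {zero}  f f-sym = refl
∑∑-symmetric {suc n} f f-sym = begin
    (f₀₀ + row) + ∑[ x < n ] (f (suc x) zero + ∑[ y < n ] f′ x y)
  ≡⟨ cong (f₀₀ + row +_) (∑-distrib-+ (λ x → f (suc x) zero) (λ x → ∑[ y < n ] f′ x y)) ⟩
    (f₀₀ + row) + (∑[ x < n ] f (suc x) zero + ∑[ x < n ] ∑[ y < n ] f′ x y)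
  ≡⟨ cong (λ column → f₀₀ + row + (column + ∑[ x < n ] ∑[ y < n ] f′ x y))
       (sum-cong-≗ (λ x → f-sym (suc x) zero)) ⟩
    (f₀₀ + row) + (row + ∑[ x < n ] ∑[ y < n ] f′ x y)
  ≡⟨ cong (λ s → f₀₀ + row + (row + s)) (∑∑-symmetric f′ (λ x y → f-sym (suc x) (suc y))) ⟩
    (f₀₀ + row) + (row + (∑[ x < n ] f′ x x + 2 * strictUpperSum f′))
  ≡⟨ rearrange f₀₀ row (∑[ x < n ] f′ x x) (strictUpperSum f′) ⟩
    (f₀₀ + ∑[ x < n ] f′ x x) + 2 * (row + strictUpperSum f′)
  ∎
  where
  open ≡-Reasoning
  f₀₀ = f zero zero
  row = ∑[ y < n ] f zero (suc y)
  f′ = λ x y → f (suc x) (suc y)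
  rearrange : ∀ c r d t → (c + r) + (r + (d + 2 * t)) ≡ (c + d) + 2 * (r + t)
  rearrange = solve-∀

∑∑-symmetrised-≤ : ∀ {n} (f g : Fin n → Fin n → ℕ) (d : Fin n → ℕ) →
  (∀ x y → g x y + g y x ≤ f x y + d x * d y) →
  2 * ∑[ x < n ] ∑[ y < n ] g x y ≤ ∑[ x < n ] ∑[ y < n ] f x y + ∑[ x < n ] d x * ∑[ x < n ] d x
∑∑-symmetrised-≤ {n} f g d g≤f = begin
    2 * G
  ≡⟨ cong (G +_) (+-identityʳ G) ⟩
    G + G
  ≡⟨ cong (G +_) (∑-comm g) ⟩
    G + ∑[ x < n ] ∑[ y < n ] g y x
  ≡⟨ ∑∑-distrib-+ g (λ x y → g y x) ⟨
    ∑[ x < n ] ∑[ y < n ] (g x y + g y x)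
  ≤⟨ ∑-mono-≤ (λ x → ∑-mono-≤ (g≤f x)) ⟩
    ∑[ x < n ] ∑[ y < n ] (f x y + d x * d y)
  ≡⟨ ∑∑-distrib-+ f (λ x y → d x * d y) ⟩
    ∑[ x < n ] ∑[ y < n ] f x y + ∑[ x < n ] ∑[ y < n ] (d x * d y)
  ≡⟨ cong (_ +_) (∑∑-* d d) ⟩
    ∑[ x < n ] ∑[ y < n ] f x y + ∑[ x < n ] d x * ∑[ x < n ] d x
  ∎
  where
  open ≤-Reasoning
  G = ∑[ x < n ] ∑[ y < n ] g x y

module SymmetricRelation {n : ℕ} {R : Fin n → Fin n → Set}
    (R? : ∀ x y → Dec (R x y)) (R-sym : ∀ {x y} → R x y → R y x) (a : Fin n) where

  count-odd : (∀ x → R x x ⇔ x ≡ a) →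
    ∃ λ t → ∑[ x < n ] ∑[ y < n ] 𝟙 (R? x y) ≡ 1 + 2 * t
  count-odd diagonal = strictUpperSum 𝟙R , (begin
      ∑[ x < n ] ∑[ y < n ] 𝟙 (R? x y)
    ≡⟨ ∑∑-symmetric 𝟙R (λ x y → 𝟙-⇔ (mk⇔ R-sym R-sym) (R? x y) (R? y x)) ⟩
      ∑[ x < n ] 𝟙 (R? x x) + 2 * strictUpperSum 𝟙R
    ≡⟨ cong (_+ 2 * strictUpperSum 𝟙R) (sum-cong-≗ (λ x → 𝟙-⇔ (diagonal x) (R? x x) (x ≟ a))) ⟩
      ∑[ x < n ] 𝟙 (x ≟ a) + 2 * strictUpperSum 𝟙R
    ≡⟨ cong (_+ 2 * strictUpperSum 𝟙R) (∑-𝟙-≟ a) ⟩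
      1 + 2 * strictUpperSum 𝟙R
    ∎)
    where
    open ≡-Reasoning
    𝟙R = λ x y → 𝟙 (R? x y)

  rectangle-≤ : {A B : Pred (Fin n) 0ℓ} (A? : Decidable A) (B? : Decidable B) →
    (∀ {x y} → A x → B y → R x y) → (∀ {x} → A x → B x → x ≡ a) →
    2 * (∑[ x < n ] 𝟙 (A? x) * ∑[ y < n ] 𝟙 (B? y)) ≤ ∑[ x < n ] ∑[ y < n ] 𝟙 (R? x y) + 1
  rectangle-≤ {A} {B} A? B? A×B⊆R A∩B⊆a =
    subst₂ (λ s t → 2 * s ≤ ∑[ x < n ] ∑[ y < n ] 𝟙 (R? x y) + t)
      (∑∑-* (𝟙 ∘ A?) (𝟙 ∘ B?)) (cong (λ k → k * k) (∑-𝟙-≟ a))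
      (∑∑-symmetrised-≤ (λ x y → 𝟙 (R? x y)) (λ x y → 𝟙 (A? x) * 𝟙 (B? y)) (λ x → 𝟙 (x ≟ a))
        pointwise)
    where
    pointwise : ∀ x y →
      𝟙 (A? x) * 𝟙 (B? y) + 𝟙 (A? y) * 𝟙 (B? x) ≤ 𝟙 (R? x y) + 𝟙 (x ≟ a) * 𝟙 (y ≟ a)
    pointwise x y =
      subst₂ (λ s t → s + t ≤ 𝟙 (R? x y) + 𝟙 (x ≟ a) * 𝟙 (y ≟ a))
        (𝟙-×-dec (A? x) (B? y)) (𝟙-×-dec (A? y) (B? x))
        (cases (A? x ×-dec B? y) (A? y ×-dec B? x))
      where
      cases : (xy? : Dec (A x × B y)) (yx? : Dec (A y × B x)) →
        𝟙 xy? + 𝟙 yx? ≤ 𝟙 (R? x y) + 𝟙 (x ≟ a) * 𝟙 (y ≟ a)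
      cases (yes (ax , by)) (yes (ay , bx)) = ≤-reflexive (sym (cong₂ _+_
        (𝟙-yes (R? x y) (A×B⊆R ax by))
        (cong₂ _*_ (𝟙-yes (x ≟ a) (A∩B⊆a ax bx)) (𝟙-yes (y ≟ a) (A∩B⊆a ay by)))))
      cases (yes (ax , by)) (no _) =
        ≤-trans (≤-reflexive (sym (𝟙-yes (R? x y) (A×B⊆R ax by)))) (m≤m+n _ _)
      cases (no _) (yes (ay , bx)) =
        ≤-trans (≤-reflexive (sym (𝟙-yes (R? x y) (R-sym (A×B⊆R ay bx))))) (m≤m+n _ _)
      cases (no _) (no _) = z≤n

odd⇒%2≡1 : ∀ {m} t → m ≡ 1 + 2 * t → m % 2 ≡ 1
odd⇒%2≡1 t refl = subst (λ s → (1 + s) % 2 ≡ 1) (*-comm t 2) ([m+kn]%n≡m%n 1 t 2)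

≤+1⇒∸1≤ : ∀ {m k} → m ≤ k + 1 → m ∸ 1 ≤ k
≤+1⇒∸1≤ {m} {k} m≤k+1 = m≤n+o⇒m∸n≤o m 1 (≤-trans m≤k+1 (≤-reflexive (+-comm k 1)))

≤-half-odd+1 : ∀ {m k} t → m ≡ 1 + 2 * t → 2 * k ≤ m + 1 → k ≤ (m + 1) / 2
≤-half-odd+1 {k = k} t refl 2k≤m+1 =
  subst (k ≤_) (sym half) (*-cancelˡ-≤ 2 (subst (2 * k ≤_) (odd+1≡2[1+t] t) 2k≤m+1))
  where
  odd+1≡2[1+t] : ∀ t → 1 + 2 * t + 1 ≡ 2 * suc t
  odd+1≡2[1+t] = solve-∀
  half : (1 + 2 * t + 1) / 2 ≡ suc t
  half = trans (cong (_/ 2) (trans (odd+1≡2[1+t] t) (*-comm 2 (suc t)))) (m*n/n≡m (suc t) 2)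

module _ {n : ℕ} (L : FiniteBoundedLattice n) (a : Fin n) where
  open FiniteBoundedLattice L using (⊥; ⊤; isBoundedLattice)

  private
    lattice : Lattice 0ℓ 0ℓ 0ℓ
    lattice = record { isLattice = IsBoundedLattice.isLattice isBoundedLattice }

  open Lattice lattice using (x∧y≤x; x≤x∨y; y≤x∨y; meetSemilattice; joinSemilattice)
    renaming (_≤_ to _⊑_; trans to ⊑-trans; antisym to ⊑-antisym)
  open import Relation.Binary.Lattice.Properties.MeetSemilattice meetSemilattice
    using (∧-comm; ∧-idempotent)
  open import Relation.Binary.Lattice.Properties.JoinSemilattice joinSemilattice
    using (∨-comm; ∨-idempotent)

  InP-sym : ∀ {x y} → InP L a (x , y) → InP L a (y , x)
  InP-sym {x} {y} (x∧y⊑a , a⊑x∨y) =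
    subst (_⊑ a) (∧-comm x y) x∧y⊑a , subst (a ⊑_) (∨-comm x y) a⊑x∨y

  InP-left : ∀ y → InP L a (a , y)
  InP-left y = x∧y≤x a y , x≤x∨y a y

  InP-diagonal : ∀ x → InP L a (x , x) ⇔ x ≡ a
  InP-diagonal x = mk⇔
    (λ (x∧x⊑a , a⊑x∨x) → ⊑-antisym (subst (_⊑ a) (∧-idempotent x) x∧x⊑a)
                                   (subst (a ⊑_) (∨-idempotent x) a⊑x∨x))
    (λ { refl → InP-left a })

  InP-interval : ∀ {x y} → x ⊑ a → a ⊑ y → InP L a (x , y)
  InP-interval {x} {y} x⊑a a⊑y = ⊑-trans (x∧y≤x x y) x⊑a , ⊑-trans a⊑y (y≤x∨y x y)

  open SymmetricRelation (λ x y → InP? L a (x , y)) InP-sym a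

  cardP-odd : ∃ λ t → cardP L a ≡ 1 + 2 * t
  cardP-odd with t , P≡1+2t ← count-odd InP-diagonal = t , trans (length-filter-allFin² (InP? L a)) P≡1+2t

  card-≤ : 2 * card L ≤ cardP L a + 1
  card-≤ = subst₂ (λ s p → 2 * s ≤ p + 1)
    (trans (cong₂ _*_ (∑-𝟙-≟ a) (∑-const-1 n)) (*-identityˡ n))
    (sym (length-filter-allFin² (InP? L a)))
    (rectangle-≤ (_≟ a) (λ _ → yes tt) (λ { refl _ → InP-left _ }) (λ x≡a _ → x≡a))

  cardInterval-≤ : 2 * cardInterval L ⊥ a * cardInterval L a ⊤ ≤ cardP L a + 1
  cardInterval-≤ = subst₂ (λ s p → s ≤ p + 1)
    (trans (cong (2 *_) (sym (cong₂ _*_ (length-filter-allFin [⊥,a]?) (length-filter-allFin [a,⊤]?))))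
           (sym (*-assoc 2 (cardInterval L ⊥ a) (cardInterval L a ⊤))))
    (sym (length-filter-allFin² (InP? L a)))
    (rectangle-≤ [⊥,a]? [a,⊤]?
      (λ (_ , x⊑a) (a⊑y , _) → InP-interval x⊑a a⊑y)
      (λ (_ , x⊑a) (a⊑x , _) → ⊑-antisym x⊑a a⊑x))
    where
    [⊥,a]? = InInterval? L ⊥ a
    [a,⊤]? = InInterval? L a ⊤

lemma14 : (n : ℕ) (L : FiniteBoundedLattice n) (a : Fin n) →
    (cardP L a % 2 ≡ 1)
    × (2 * card L ∸ 1 ≤ cardP L a)
    × (card L ≤ (cardP L a + 1) / 2)
    × (2 * cardInterval L (FiniteBoundedLattice.⊥ L) a
         * cardInterval L a (FiniteBoundedLattice.⊤ L) ∸ 1 ≤ cardP L a)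
lemma14 n L a with t , P≡1+2t ← cardP-odd L a =
    odd⇒%2≡1 t P≡1+2t
  , ≤+1⇒∸1≤ (card-≤ L a)
  , ≤-half-odd+1 t P≡1+2t (card-≤ L a)
  , ≤+1⇒∸1≤ (cardInterval-≤ L a)
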